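{- Let $I_4=\{1,2,3,4\}$, let $\mathfrak{N}$ be a Veblen configuration defined on $\wp_2(I_4)$, and let $\varphi\in S_{I_4}$. Then every automorphism $f$ of $\mathfrak{K}_{\varphi,\mathfrak{N}}=\mathbf{\Pi}(p,\bar\varphi\varkappa,\mathfrak{N})$ satisfies $f(p)=p$.
   Context: $\wp_2(I_4)$ is the set of 2-element subsets of $I_4$ and $S_{I_4}$ the group of permutations of $I_4$. For $\varphi\in S_{I_4}$, $\bar\varphi$ is the induced bijection $\{i,j\}\mapsto\{\varphi(i),\varphi(j)\}$ of $\wp_2(I_4)$; $\varkappa(u)=I_4\setminus u$ for $u\in\wp_2(I_4)$. A Veblen configuration on $\wp_2(I_4)$ is a family of four 3-element subsets of $\wp_2(I_4)$ ("lines") such that every element of $\wp_2(I_4)$ lies on exactly two lines and any two lines meet in exactly one element. Take pairwise distinct symbols $p$, $a_i,b_i$ ($i\in I_4$), $c_u$ ($u\in\wp_2(I_4)$). For a bijection $\delta$ of $\wp_2(I_4)$, $\mathbf{\Pi}(p,\delta,\mathfrak{N})$ is the incidence structure with points $p,a_i,b_i,c_u$ and lines: $\{c_u:u\in L\}$ for each line $L$ of $\mathfrak{N}$; $\{a_i,a_j,c_{\{i,j\}}\}$ and $\{b_i,b_j,c_{\delta^{ -1}(\{i,j\})}\}$ for $\{i,j\}\in\wp_2(I_4)$; and $\{p,a_i,b_i\}$ for $i\in I_4$. An automorphism is a bijection of the point set mapping lines onto lines. -}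

module Defs where

open import Data.Nat.Base as ℕ using (ℕ; z≤n; s≤s)
open import Data.Fin.Base using (Fin; zero; suc; _<_)
open import Data.Fin.Properties using (<-cmp; <-irrefl)
open import Data.Fin.Permutation using (Permutation′; _⟨$⟩ʳ_; _⟨$⟩ˡ_; inverseˡ)
open import Data.Product.Base using (Σ; ∃; ∃-syntax; _×_; _,_)
open import Data.Sum.Base using (_⊎_)
open import Data.Empty using (⊥-elim)
open import Relation.Binary.Definitions using (tri<; tri≈; tri>)
open import Relation.Binary.PropositionalEquality using (_≡_; _≢_; refl; sym; trans; cong)
open import Function.Bundles using (_⤖_; Bijection; _⇔_)

-- I₄ = {1,2,3,4} is represented by Fin 4 (elements 0,1,2,3).

I₄ : Set
I₄ = Fin 4

-- ℘₂(I₄): 2-element subsets {i,j} of I₄, represented canonically as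
-- ordered pairs (lo , hi) with lo < hi (proofs of < are irrelevant).

record P2 : Set where
  constructor ⟨_,_∣_⟩
  field
    lo : I₄
    hi : I₄
    lo<hi : lo < hi
open P2 public

_∈₂_ : I₄ → P2 → Set
k ∈₂ u = k ≡ lo u ⊎ k ≡ hi u

bar : Permutation′ 4 → P2 → P2
bar φ ⟨ i , j ∣ i<j ⟩ with <-cmp (φ ⟨$⟩ʳ i) (φ ⟨$⟩ʳ j)
... | tri< a _ _ = ⟨ φ ⟨$⟩ʳ i , φ ⟨$⟩ʳ j ∣ a ⟩
... | tri≈ _ e _ = ⊥-elim (<-irrefl i≡j i<j)
  where
  i≡j : i ≡ j
  i≡j = trans (sym (inverseˡ φ)) (trans (cong (φ ⟨$⟩ˡ_) e) (inverseˡ φ))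
... | tri> _ _ c = ⟨ φ ⟨$⟩ʳ j , φ ⟨$⟩ʳ i ∣ c ⟩

-- κ(u) = I₄ ∖ u (complement of a 2-subset; explicit table).

κ : P2 → P2
κ ⟨ zero , suc zero ∣ _ ⟩ = ⟨ suc (suc zero) , suc (suc (suc zero)) ∣ s≤s (s≤s (s≤s z≤n)) ⟩
κ ⟨ zero , suc (suc zero) ∣ _ ⟩ = ⟨ suc zero , suc (suc (suc zero)) ∣ s≤s (s≤s z≤n) ⟩
κ ⟨ zero , suc (suc (suc zero)) ∣ _ ⟩ = ⟨ suc zero , suc (suc zero) ∣ s≤s (s≤s z≤n) ⟩
κ ⟨ suc zero , suc (suc zero) ∣ _ ⟩ = ⟨ zero , suc (suc (suc zero)) ∣ s≤s z≤n ⟩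
κ ⟨ suc zero , suc (suc (suc zero)) ∣ _ ⟩ = ⟨ zero , suc (suc zero) ∣ s≤s z≤n ⟩
κ ⟨ suc (suc zero) , suc (suc (suc zero)) ∣ _ ⟩ = ⟨ zero , suc zero ∣ s≤s z≤n ⟩
κ ⟨ zero , zero ∣ () ⟩
κ ⟨ suc zero , zero ∣ () ⟩
κ ⟨ suc zero , suc zero ∣ s≤s () ⟩
κ ⟨ suc (suc zero) , zero ∣ () ⟩
κ ⟨ suc (suc zero) , suc zero ∣ s≤s () ⟩
κ ⟨ suc (suc zero) , suc (suc zero) ∣ s≤s (s≤s ()) ⟩
κ ⟨ suc (suc (suc zero)) , zero ∣ () ⟩
κ ⟨ suc (suc (suc zero)) , suc zero ∣ s≤s () ⟩
κ ⟨ suc (suc (suc zero)) , suc (suc zero) ∣ s≤s (s≤s ()) ⟩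
κ ⟨ suc (suc (suc zero)) , suc (suc (suc zero)) ∣ s≤s (s≤s (s≤s ())) ⟩

record Veblen : Set where
  field
    line : Fin 4 → Fin 3 → P2
    line-3 : ∀ k (s t : Fin 3) → line k s ≡ line k t → s ≡ t

  _∈V_ : P2 → Fin 4 → Set
  u ∈V k = ∃[ s ] line k s ≡ u

  field
    on-two : ∀ u → ∃[ k₁ ] ∃[ k₂ ] (k₁ ≢ k₂ × u ∈V k₁ × u ∈V k₂ ×
               (∀ k → u ∈V k → k ≡ k₁ ⊎ k ≡ k₂))
    meet-one : ∀ k₁ k₂ → k₁ ≢ k₂ → ∃[ u ] ((u ∈V k₁ × u ∈V k₂) ×
               (∀ w → w ∈V k₁ → w ∈V k₂ → w ≡ u))
open Veblen public

data Point : Set where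
  p : Point
  a : I₄ → Point
  b : I₄ → Point
  c : P2 → Point

data Line : Set where
  vLine : Fin 4 → Line
  aLine : P2 → Line
  bLine : P2 → Line
  pLine : I₄ → Line

-- incidence of Π(p, δ, 𝔑).  For bLine v the point c_{δ⁻¹(v)} is
-- described as c_u with δ(u) = v (δ is a bijection).
Inc : Veblen → (P2 → P2) → Point → Line → Set
Inc N δ x (vLine k) = ∃[ u ] (_∈V_ N u k × x ≡ c u)
Inc N δ x (aLine v) = (∃[ i ] (i ∈₂ v × x ≡ a i)) ⊎ x ≡ c v
Inc N δ x (bLine v) = (∃[ i ] (i ∈₂ v × x ≡ b i)) ⊎ (∃[ u ] (δ u ≡ v × x ≡ c u))
Inc N δ x (pLine i) = x ≡ p ⊎ x ≡ a i ⊎ x ≡ b i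

ImageIs : Veblen → (P2 → P2) → (Point → Point) → Line → Line → Set
ImageIs N δ f L L' = ∀ y → Inc N δ y L' ⇔ (∃[ x ] (Inc N δ x L × f x ≡ y))

IsAutomorphism : Veblen → (P2 → P2) → Point ⤖ Point → Set
IsAutomorphism N δ f =
  (∀ L → ∃[ L' ] ImageIs N δ (Bijection.to f) L L') ×
  (∀ L' → ∃[ L ] ImageIs N δ (Bijection.to f) L L')

-- 𝔎_{φ,𝔑} = Π(p, φ̄ ∘ κ, 𝔑)
δK : Permutation′ 4 → P2 → P2
δK φ u = bar φ (κ u)

module Submission where

open import Defs
open import Data.Nat.Base as ℕ using (z≤n; s≤s)
open import Data.Fin.Base using (Fin; zero; suc; _<_; punchIn; punchOut)
open import Data.Fin.Permutation using (Permutation′; _⟨$⟩ʳ_; _⟨$⟩ˡ_; inverseˡ; inverseʳ)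
open import Function.Properties.Inverse using (↔⇒↣)
import Function.Properties.Equivalence as ⇔
open import Data.Fin.Properties using (_≟_; <-irrefl; <-irrelevant; <-cmp; <-trans; any?; all?; punchInᵢ≢i; punchIn-punchOut; punchIn-injective; punchOut-injective)
open import Data.Product.Base using (∃; ∃-syntax; _×_; _,_; proj₁; proj₂)
open import Data.Sum.Base as Sum using (_⊎_; inj₁; inj₂)
open import Data.Empty using (⊥-elim)
open import Data.Unit.Base using (tt)
open import Function.Base using (_∘_; id)
open import Function.Bundles using (_⇔_; mk⇔; Equivalence; _⤖_; Bijection; Injection)
open import Relation.Nullary using (¬_; Dec; yes; no)
open import Relation.Nullary.Decidable using (True; toWitness; ¬?; _×-dec_; _→-dec_; decidable-stable)
open import Relation.Binary.Definitions using (DecidableEquality; tri<; tri≈; tri>)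
open import Relation.Binary.PropositionalEquality using (_≡_; _≢_; refl; sym; trans; cong; subst; module ≡-Reasoning)

-- An automorphism preserves every property of a point that is expressed
-- through incidence alone.  Two such properties fail at p: the points
-- collinear with p are the aᵢ and bᵢ, any two a's (or two b's) are
-- collinear, and aᵢ, bⱼ are joined only by a line through p.  Every other
-- point has one of them.  For aᵢ, bᵢ and the c_u with δu ≠ u there is a
-- line through the point none of whose other points is collinear with a
-- fixed neighbour (a blind point); for c_u with δu = u the neighbours
-- b_t, a_t, c_v form a broken path (a kinked point), where v is one of two
-- candidates, chosen using that in a Veblen configuration every u is
-- joined to at least one of any two points.

punchIn²-onto : ∀ {n} {i j : Fin (ℕ.suc (ℕ.suc n))} (i≢j : i ≢ j) {x} → x ≢ i → x ≢ j →
                ∃[ k ] punchIn i (punchIn (punchOut i≢j) k) ≡ x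
punchIn²-onto {n} {i} {j} i≢j {x} x≢i x≢j = punchOut j′≢x′ , (begin
    punchIn i (punchIn j′ (punchOut j′≢x′))  ≡⟨ cong (punchIn i) (punchIn-punchOut j′≢x′) ⟩
    punchIn i x′                             ≡⟨ punchIn-punchOut (x≢i ∘ sym) ⟩
    x                                        ∎)
  where
  open ≡-Reasoning
  j′ x′ : Fin (ℕ.suc n)
  j′ = punchOut i≢j
  x′ = punchOut (x≢i ∘ sym)
  j′≢x′ : j′ ≢ x′
  j′≢x′ = x≢j ∘ sym ∘ punchOut-injective i≢j (x≢i ∘ sym)

P2-ext : ∀ {u w} → lo u ≡ lo w → hi u ≡ hi w → u ≡ w
P2-ext {⟨ i , j ∣ r ⟩} {⟨ .i , .j ∣ r′ ⟩} refl refl = cong ⟨ i , j ∣_⟩ (<-irrelevant r r′)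

_≟₂_ : DecidableEquality P2
u ≟₂ w with lo u ≟ lo w | hi u ≟ hi w
... | yes lo≡ | yes hi≡ = yes (P2-ext lo≡ hi≡)
... | no lo≢ | _ = no (lo≢ ∘ cong lo)
... | yes _ | no hi≢ = no (hi≢ ∘ cong hi)

_∈₂?_ : ∀ t u → Dec (t ∈₂ u)
t ∈₂? u with t ≟ lo u | t ≟ hi u
... | yes t≡lo | _ = yes (inj₁ t≡lo)
... | no _ | yes t≡hi = yes (inj₂ t≡hi)
... | no t≢lo | no t≢hi = no λ { (inj₁ t≡lo) → t≢lo t≡lo ; (inj₂ t≡hi) → t≢hi t≡hi }

⊆⇒≡ : ∀ {u w} → lo u ∈₂ w → hi u ∈₂ w → u ≡ w
⊆⇒≡ {u} (inj₁ lo≡) (inj₁ hi≡) = ⊥-elim (<-irrefl (trans lo≡ (sym hi≡)) (lo<hi u))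
⊆⇒≡ (inj₁ lo≡) (inj₂ hi≡) = P2-ext lo≡ hi≡
⊆⇒≡ {u} {w} (inj₂ refl) (inj₁ refl) = ⊥-elim (<-irrefl refl (<-trans (lo<hi w) (lo<hi u)))
⊆⇒≡ {u} (inj₂ lo≡) (inj₂ hi≡) = ⊥-elim (<-irrefl (trans lo≡ (sym hi≡)) (lo<hi u))

≢⇒∃∈∉ : ∀ {u w} → u ≢ w → ∃[ t ] (t ∈₂ u × ¬ t ∈₂ w)
≢⇒∃∈∉ {u} {w} u≢w with lo u ∈₂? w | hi u ∈₂? w
... | yes lo∈ | yes hi∈ = ⊥-elim (u≢w (⊆⇒≡ lo∈ hi∈))
... | no lo∉ | _ = lo u , inj₁ refl , lo∉
... | yes _ | no hi∉ = hi u , inj₂ refl , hi∉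

pair : ∀ {i j} → i ≢ j → ∃[ v ] (i ∈₂ v × j ∈₂ v)
pair {i} {j} i≢j with <-cmp i j
... | tri< i<j _ _ = ⟨ i , j ∣ i<j ⟩ , inj₁ refl , inj₂ refl
... | tri≈ _ i≡j _ = ⊥-elim (i≢j i≡j)
... | tri> _ _ j<i = ⟨ j , i ∣ j<i ⟩ , inj₂ refl , inj₁ refl

through : ∀ i j → ∃[ v ] (i ∈₂ v × j ∈₂ v)
through i j with i ≟ j
... | no i≢j = pair i≢j
... | yes refl with pair (punchInᵢ≢i i zero ∘ sym)
...   | v , i∈v , _ = v , i∈v , i∈v

P2-elim : (P : P2 → Set) →
          P ⟨ zero , suc zero ∣ s≤s z≤n ⟩ →
          P ⟨ zero , suc (suc zero) ∣ s≤s z≤n ⟩ →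
          P ⟨ zero , suc (suc (suc zero)) ∣ s≤s z≤n ⟩ →
          P ⟨ suc zero , suc (suc zero) ∣ s≤s (s≤s z≤n) ⟩ →
          P ⟨ suc zero , suc (suc (suc zero)) ∣ s≤s (s≤s z≤n) ⟩ →
          P ⟨ suc (suc zero) , suc (suc (suc zero)) ∣ s≤s (s≤s (s≤s z≤n)) ⟩ →
          ∀ v → P v
P2-elim P p01 _ _ _ _ _ ⟨ zero , suc zero ∣ s≤s z≤n ⟩ = p01
P2-elim P _ p02 _ _ _ _ ⟨ zero , suc (suc zero) ∣ s≤s z≤n ⟩ = p02
P2-elim P _ _ p03 _ _ _ ⟨ zero , suc (suc (suc zero)) ∣ s≤s z≤n ⟩ = p03
P2-elim P _ _ _ p12 _ _ ⟨ suc zero , suc (suc zero) ∣ s≤s (s≤s z≤n) ⟩ = p12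
P2-elim P _ _ _ _ p13 _ ⟨ suc zero , suc (suc (suc zero)) ∣ s≤s (s≤s z≤n) ⟩ = p13
P2-elim P _ _ _ _ _ p23 ⟨ suc (suc zero) , suc (suc (suc zero)) ∣ s≤s (s≤s (s≤s z≤n)) ⟩ = p23
P2-elim P _ _ _ _ _ _ ⟨ i , zero ∣ () ⟩
P2-elim P _ _ _ _ _ _ ⟨ suc zero , suc zero ∣ s≤s () ⟩
P2-elim P _ _ _ _ _ _ ⟨ suc (suc zero) , suc zero ∣ s≤s () ⟩
P2-elim P _ _ _ _ _ _ ⟨ suc (suc (suc zero)) , suc zero ∣ s≤s () ⟩
P2-elim P _ _ _ _ _ _ ⟨ suc (suc zero) , suc (suc zero) ∣ s≤s (s≤s ()) ⟩
P2-elim P _ _ _ _ _ _ ⟨ suc (suc (suc zero)) , suc (suc zero) ∣ s≤s (s≤s ()) ⟩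
P2-elim P _ _ _ _ _ _ ⟨ suc (suc (suc zero)) , suc (suc (suc zero)) ∣ s≤s (s≤s (s≤s ())) ⟩

κ-complement : ∀ v m → m ∈₂ κ v ⇔ (¬ m ∈₂ v)
κ-complement v m = mk⇔ (proj₁ (complement v m)) (proj₂ (complement v m))
  where
  Complement : P2 → I₄ → Set
  Complement v m = (m ∈₂ κ v → ¬ m ∈₂ v) × (¬ m ∈₂ v → m ∈₂ κ v)
  complement? : ∀ v → Dec (∀ m → Complement v m)
  complement? v = all? λ m → ((m ∈₂? κ v) →-dec ¬? (m ∈₂? v)) ×-dec (¬? (m ∈₂? v) →-dec (m ∈₂? κ v))
  complement : ∀ v m → Complement v m
  complement v = toWitness (P2-elim (True ∘ complement?) tt tt tt tt tt tt v)

∈-bar : ∀ (φ : Permutation′ 4) w {t} → t ∈₂ bar φ w ⇔ (φ ⟨$⟩ˡ t) ∈₂ w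
∈-bar φ w {t} = mk⇔ (reflect w) λ φ⁻¹t∈w → subst (_∈₂ bar φ w) (inverseʳ φ) (preserve w φ⁻¹t∈w)
  where
  φ-injective : ∀ {i j} → φ ⟨$⟩ʳ i ≡ φ ⟨$⟩ʳ j → i ≡ j
  φ-injective = Injection.injective (↔⇒↣ φ)
  preserve : ∀ w {m} → m ∈₂ w → (φ ⟨$⟩ʳ m) ∈₂ bar φ w
  preserve ⟨ i , j ∣ i<j ⟩ m∈w with <-cmp (φ ⟨$⟩ʳ i) (φ ⟨$⟩ʳ j)
  ... | tri< _ _ _ = Sum.map (cong (φ ⟨$⟩ʳ_)) (cong (φ ⟨$⟩ʳ_)) m∈w
  ... | tri≈ _ φi≡φj _ = ⊥-elim (<-irrefl (φ-injective φi≡φj) i<j)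
  ... | tri> _ _ _ = Sum.swap (Sum.map (cong (φ ⟨$⟩ʳ_)) (cong (φ ⟨$⟩ʳ_)) m∈w)
  reflect : ∀ w {t} → t ∈₂ bar φ w → (φ ⟨$⟩ˡ t) ∈₂ w
  reflect ⟨ i , j ∣ i<j ⟩ t∈w with <-cmp (φ ⟨$⟩ʳ i) (φ ⟨$⟩ʳ j) | t∈w
  ... | tri< _ _ _ | inj₁ refl = inj₁ (inverseˡ φ)
  ... | tri< _ _ _ | inj₂ refl = inj₂ (inverseˡ φ)
  ... | tri≈ _ φi≡φj _ | _ = ⊥-elim (<-irrefl (φ-injective φi≡φj) i<j)
  ... | tri> _ _ _ | inj₁ refl = inj₂ (inverseˡ φ)
  ... | tri> _ _ _ | inj₂ refl = inj₁ (inverseˡ φ)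

module VeblenProperties (N : Veblen) where

  Joined : P2 → P2 → Set
  Joined u v = ∃[ k ] (_∈V_ N u k × _∈V_ N v k)

  _∈V?_ : ∀ u k → Dec (_∈V_ N u k)
  u ∈V? k = any? λ s → line N k s ≟₂ u

  joined? : ∀ u v → Dec (Joined u v)
  joined? u v = any? λ k → (u ∈V? k) ×-dec (v ∈V? k)

  unjoined-unique : ∀ u {v w} → ¬ Joined u v → ¬ Joined u w → v ≡ w
  -- u lies on two of the four lines; a point not joined to u lies on the other
  -- two, and these meet in a single point.
  unjoined-unique u {v} {w} ¬uv ¬uw with on-two N u
  ... | k₁ , k₂ , k₁≢k₂ , u∈k₁ , u∈k₂ , _ = trans (at-meet ¬uv) (sym (at-meet ¬uw))
    where
    others : Fin 2 → Fin 4
    others k = punchIn k₁ (punchIn (punchOut k₁≢k₂) k)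
    others-injective : others zero ≢ others (suc zero)
    others-injective = (λ ()) ∘ punchIn-injective _ _ _ ∘ punchIn-injective k₁ _ _
    line-of-unjoined : ∀ {x l} → ¬ Joined u x → _∈V_ N x l → ∃[ k ] others k ≡ l
    line-of-unjoined ¬ux x∈l =
      punchIn²-onto k₁≢k₂ (λ { refl → ¬ux (_ , u∈k₁ , x∈l) }) (λ { refl → ¬ux (_ , u∈k₂ , x∈l) })
    on-others : ∀ {x} → ¬ Joined u x → _∈V_ N x (others zero) × _∈V_ N x (others (suc zero))
    on-others {x} ¬ux with on-two N x
    ... | l₁ , l₂ , l₁≢l₂ , x∈l₁ , x∈l₂ , _
        with line-of-unjoined ¬ux x∈l₁ | line-of-unjoined ¬ux x∈l₂
    ... | zero , refl | zero , refl = ⊥-elim (l₁≢l₂ refl)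
    ... | zero , refl | suc zero , refl = x∈l₁ , x∈l₂
    ... | suc zero , refl | zero , refl = x∈l₂ , x∈l₁
    ... | suc zero , refl | suc zero , refl = ⊥-elim (l₁≢l₂ refl)
    meet = meet-one N (others zero) (others (suc zero)) others-injective
    at-meet : ∀ {x} → ¬ Joined u x → x ≡ proj₁ meet
    at-meet {x} ¬ux = proj₂ (proj₂ meet) x (proj₁ (on-others ¬ux)) (proj₂ (on-others ¬ux))

  joined-to-one-of : ∀ u {v w} → v ≢ w → Joined u v ⊎ Joined u w
  joined-to-one-of u {v} {w} v≢w with joined? u v | joined? u w
  ... | yes uv | _ = inj₁ uv
  ... | no _ | yes uw = inj₂ uw
  ... | no ¬uv | no ¬uw = ⊥-elim (v≢w (unjoined-unique u ¬uv ¬uw))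

module IncidenceStructure {P L : Set} (_on_ : P → L → Set) where

  Collinear : P → P → Set
  Collinear x y = ∃[ l ] (x on l × y on l)

  JoinedAvoiding : P → P → P → Set
  JoinedAvoiding x y z = ∃[ l ] (¬ x on l × y on l × z on l)

  record Blind (x : P) : Set where
    constructor blind
    field
      y : P
      y≢x : y ≢ x
      x∼y : Collinear x y
      m : L
      x-on-m : x on m
      y-misses-m : ∀ w → w on m → w ≢ x → ¬ Collinear y w

  record Kinked (x : P) : Set where
    constructor kinked
    field
      y₁ y₂ y₃ : P
      y₁≢x : y₁ ≢ x
      y₂≢x : y₂ ≢ x
      y₃≢x : y₃ ≢ x
      x∼y₁ : Collinear x y₁
      x∼y₂ : Collinear x y₂
      x∼y₃ : Collinear x y₃
      y₁y₂-avoid-x : JoinedAvoiding x y₁ y₂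
      y₂y₃-avoid-x : JoinedAvoiding x y₂ y₃
      ¬y₁∼y₃ : ¬ Collinear y₁ y₃

  collinear-sym : ∀ {x y} → Collinear x y → Collinear y x
  collinear-sym (l , x-on , y-on) = l , y-on , x-on

  joinedAvoiding-sym : ∀ {x y z} → JoinedAvoiding x y z → JoinedAvoiding x z y
  joinedAvoiding-sym (l , x-off , y-on , z-on) = l , x-off , z-on , y-on

  Irregular : P → Set
  Irregular x = Blind x ⊎ Kinked x

  Image : (P → P) → L → L → Set
  Image f l l′ = ∀ y → y on l′ ⇔ (∃[ x ] (x on l × f x ≡ y))

  module Reflection (f : P ⤖ P)
                    (image : ∀ l → ∃[ l′ ] Image (Bijection.to f) l l′)
                    (preimage : ∀ l′ → ∃[ l ] Image (Bijection.to f) l l′) where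
    open Bijection f using (to; injective; strictlySurjective)

    on-preserved : ∀ {l l′ x} → Image to l l′ → x on l → to x on l′
    on-preserved {x = x} im x-on-l = Equivalence.from (im (to x)) (x , x-on-l , refl)

    on-reflected : ∀ {l l′ x} → Image to l l′ → to x on l′ → x on l
    on-reflected {l} {x = x} im fx-on-l′ with Equivalence.to (im (to x)) fx-on-l′
    ... | x′ , x′-on-l , fx′≡fx = subst (_on l) (injective fx′≡fx) x′-on-l

    collinear-preserved : ∀ {x y} → Collinear x y → Collinear (to x) (to y)
    collinear-preserved (l , x-on , y-on) with image l
    ... | l′ , im = l′ , on-preserved im x-on , on-preserved im y-on

    collinear-reflected : ∀ {x y} → Collinear (to x) (to y) → Collinear x y
    collinear-reflected (l′ , x-on , y-on) with preimage l′
    ... | l , im = l , on-reflected im x-on , on-reflected im y-on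

    joinedAvoiding-reflected : ∀ {x y z} → JoinedAvoiding (to x) (to y) (to z) → JoinedAvoiding x y z
    joinedAvoiding-reflected (l′ , x-off , y-on , z-on) with preimage l′
    ... | l , im = l , x-off ∘ on-preserved im , on-reflected im y-on , on-reflected im z-on

    blind-reflected : ∀ {x} → Blind (to x) → Blind x
    blind-reflected (blind y′ y′≢fx fx∼y′ m′ fx-on-m′ y′-misses-m′)
      with strictlySurjective y′ | preimage m′
    ... | y , refl | m , im =
      blind y (y′≢fx ∘ cong to) (collinear-reflected fx∼y′) m (on-reflected im fx-on-m′)
        λ w w-on-m w≢x y∼w →
          y′-misses-m′ (to w) (on-preserved im w-on-m) (w≢x ∘ injective) (collinear-preserved y∼w)

    kinked-reflected : ∀ {x} → Kinked (to x) → Kinked x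
    kinked-reflected (kinked y₁′ y₂′ y₃′ y₁′≢fx y₂′≢fx y₃′≢fx fx∼y₁′ fx∼y₂′ fx∼y₃′ y₁′y₂′ y₂′y₃′ ¬y₁′∼y₃′)
      with strictlySurjective y₁′ | strictlySurjective y₂′ | strictlySurjective y₃′
    ... | y₁ , refl | y₂ , refl | y₃ , refl =
      kinked y₁ y₂ y₃ (y₁′≢fx ∘ cong to) (y₂′≢fx ∘ cong to) (y₃′≢fx ∘ cong to)
             (collinear-reflected fx∼y₁′) (collinear-reflected fx∼y₂′) (collinear-reflected fx∼y₃′)
             (joinedAvoiding-reflected y₁′y₂′) (joinedAvoiding-reflected y₂′y₃′)
             (¬y₁′∼y₃′ ∘ collinear-preserved)

    irregular-reflected : ∀ {x} → Irregular (to x) → Irregular x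
    irregular-reflected = Sum.map blind-reflected kinked-reflected

module ΠProperties (N : Veblen) (δ : P2 → P2) where
  open IncidenceStructure (Inc N δ) public

  lines-through-p : ∀ {l} → Inc N δ p l → ∃[ i ] l ≡ pLine i
  lines-through-p {vLine _} (_ , _ , ())
  lines-through-p {aLine _} (inj₁ (_ , _ , ()))
  lines-through-p {aLine _} (inj₂ ())
  lines-through-p {bLine _} (inj₁ (_ , _ , ()))
  lines-through-p {bLine _} (inj₂ (_ , _ , ()))
  lines-through-p {pLine i} _ = i , refl

  link-of-p : ∀ {y} → Collinear p y → y ≢ p → ∃[ i ] (y ≡ a i ⊎ y ≡ b i)
  link-of-p (l , p-on , y-on) y≢p with lines-through-p p-on
  ... | i , refl with y-on
  ...   | inj₁ y≡p = ⊥-elim (y≢p y≡p)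
  ...   | inj₂ y≡aᵢ⊎bᵢ = i , y≡aᵢ⊎bᵢ

  collinear-aa : ∀ i j → Collinear (a i) (a j)
  collinear-aa i j with through i j
  ... | v , i∈v , j∈v = aLine v , inj₁ (i , i∈v , refl) , inj₁ (j , j∈v , refl)

  collinear-bb : ∀ i j → Collinear (b i) (b j)
  collinear-bb i j with through i j
  ... | v , i∈v , j∈v = bLine v , inj₁ (i , i∈v , refl) , inj₁ (j , j∈v , refl)

  collinear-ab⇒≡ : ∀ {i j} → Collinear (a i) (b j) → i ≡ j
  collinear-ab⇒≡ (vLine _ , (_ , _ , ()) , _)
  collinear-ab⇒≡ (aLine _ , _ , inj₁ (_ , _ , ()))
  collinear-ab⇒≡ (aLine _ , _ , inj₂ ())
  collinear-ab⇒≡ (bLine _ , inj₁ (_ , _ , ()) , _)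
  collinear-ab⇒≡ (bLine _ , inj₂ (_ , _ , ()) , _)
  collinear-ab⇒≡ (pLine _ , inj₁ () , _)
  collinear-ab⇒≡ (pLine _ , inj₂ (inj₂ ()) , _)
  collinear-ab⇒≡ (pLine _ , inj₂ (inj₁ refl) , inj₁ ())
  collinear-ab⇒≡ (pLine _ , inj₂ (inj₁ refl) , inj₂ (inj₁ ()))
  collinear-ab⇒≡ (pLine _ , inj₂ (inj₁ refl) , inj₂ (inj₂ refl)) = refl

  collinear-ac⇒∈ : ∀ {i v} → Collinear (a i) (c v) → i ∈₂ v
  collinear-ac⇒∈ (vLine _ , (_ , _ , ()) , _)
  collinear-ac⇒∈ (aLine _ , inj₁ (_ , _ , refl) , inj₁ (_ , _ , ()))
  collinear-ac⇒∈ (aLine _ , inj₁ (_ , i∈v , refl) , inj₂ refl) = i∈v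
  collinear-ac⇒∈ (aLine _ , inj₂ () , _)
  collinear-ac⇒∈ (bLine _ , inj₁ (_ , _ , ()) , _)
  collinear-ac⇒∈ (bLine _ , inj₂ (_ , _ , ()) , _)
  collinear-ac⇒∈ (pLine _ , _ , inj₁ ())
  collinear-ac⇒∈ (pLine _ , _ , inj₂ (inj₁ ()))
  collinear-ac⇒∈ (pLine _ , _ , inj₂ (inj₂ ()))

  collinear-bc⇒∈ : ∀ {i v} → Collinear (b i) (c v) → i ∈₂ δ v
  collinear-bc⇒∈ (vLine _ , (_ , _ , ()) , _)
  collinear-bc⇒∈ (aLine _ , inj₁ (_ , _ , ()) , _)
  collinear-bc⇒∈ (aLine _ , inj₂ () , _)
  collinear-bc⇒∈ (bLine _ , inj₁ (_ , _ , refl) , inj₁ (_ , _ , ()))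
  collinear-bc⇒∈ (bLine _ , inj₁ (_ , i∈w , refl) , inj₂ (_ , refl , refl)) = i∈w
  collinear-bc⇒∈ (bLine _ , inj₂ (_ , _ , ()) , _)
  collinear-bc⇒∈ (pLine _ , _ , inj₁ ())
  collinear-bc⇒∈ (pLine _ , _ , inj₂ (inj₁ ()))
  collinear-bc⇒∈ (pLine _ , _ , inj₂ (inj₂ ()))

  ¬ab-avoid-p : ∀ {i j} → ¬ JoinedAvoiding p (a i) (b j)
  ¬ab-avoid-p (vLine _ , _ , (_ , _ , ()) , _)
  ¬ab-avoid-p (aLine _ , _ , _ , inj₁ (_ , _ , ()))
  ¬ab-avoid-p (aLine _ , _ , _ , inj₂ ())
  ¬ab-avoid-p (bLine _ , _ , inj₁ (_ , _ , ()) , _)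
  ¬ab-avoid-p (bLine _ , _ , inj₂ (_ , _ , ()) , _)
  ¬ab-avoid-p (pLine _ , p-off , _ , _) = p-off (inj₁ refl)

  p-not-blind : ¬ Blind p
  p-not-blind (blind y y≢p p∼y m p-on-m y-misses-m) with link-of-p p∼y y≢p | lines-through-p p-on-m
  ... | i , inj₁ refl | k , refl = y-misses-m (a k) (inj₂ (inj₁ refl)) (λ ()) (collinear-aa i k)
  ... | i , inj₂ refl | k , refl = y-misses-m (b k) (inj₂ (inj₂ refl)) (λ ()) (collinear-bb i k)

  p-not-kinked : ¬ Kinked p
  p-not-kinked (kinked _ _ _ y₁≢p y₂≢p y₃≢p p∼y₁ p∼y₂ p∼y₃ y₁y₂ y₂y₃ ¬y₁∼y₃)
    with link-of-p p∼y₁ y₁≢p | link-of-p p∼y₂ y₂≢p | link-of-p p∼y₃ y₃≢p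
  ... | i , inj₁ refl | _ , inj₁ refl | k , inj₁ refl = ¬y₁∼y₃ (collinear-aa i k)
  ... | i , inj₂ refl | _ , inj₂ refl | k , inj₂ refl = ¬y₁∼y₃ (collinear-bb i k)
  ... | _ , inj₁ refl | _ , inj₂ refl | _ = ¬ab-avoid-p y₁y₂
  ... | _ , inj₂ refl | _ , inj₁ refl | _ = ¬ab-avoid-p (joinedAvoiding-sym y₁y₂)
  ... | _ | _ , inj₁ refl | _ , inj₂ refl = ¬ab-avoid-p y₂y₃
  ... | _ | _ , inj₂ refl | _ , inj₁ refl = ¬ab-avoid-p (joinedAvoiding-sym y₂y₃)

  p-regular : ¬ Irregular p
  p-regular = Sum.[ p-not-blind , p-not-kinked ]

module 𝔎Properties (N : Veblen) (φ : Permutation′ 4) where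
  open ΠProperties N (δK φ) public
  open VeblenProperties N
  open Equivalence using (to; from)

  ∈-δK : ∀ v {t} → t ∈₂ δK φ v ⇔ (¬ (φ ⟨$⟩ˡ t) ∈₂ v)
  ∈-δK v = ⇔.trans (∈-bar φ (κ v)) (κ-complement v _)

  δK-injective : ∀ {u w} → δK φ u ≡ δK φ w → u ≡ w
  δK-injective {u} {w} δu≡δw = ⊆⇒≡ (⊆ (inj₁ refl)) (⊆ (inj₂ refl))
    where
    φm∈δK : ∀ {v m} → (φ ⟨$⟩ʳ m) ∈₂ δK φ v ⇔ (¬ m ∈₂ v)
    φm∈δK {v} {m} = subst (λ k → (φ ⟨$⟩ʳ m) ∈₂ δK φ v ⇔ (¬ k ∈₂ v)) (inverseˡ φ) (∈-δK v)
    ⊆ : ∀ {m} → m ∈₂ u → m ∈₂ w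
    ⊆ {m} m∈u = decidable-stable (m ∈₂? w) λ m∉w →
      to φm∈δK (subst ((φ ⟨$⟩ʳ m) ∈₂_) (sym δu≡δw) (from φm∈δK m∉w)) m∈u

  a-blind : ∀ i → Blind (a i)
  a-blind i with through i (φ ⟨$⟩ˡ i)
  ... | v , i∈v , φ⁻¹i∈v =
    blind (b i) (λ ()) (pLine i , inj₂ (inj₁ refl) , inj₂ (inj₂ refl))
          (aLine v) (inj₁ (i , i∈v , refl)) misses
    where
    misses : ∀ w → Inc N (δK φ) w (aLine v) → w ≢ a i → ¬ Collinear (b i) w
    misses _ (inj₁ (j , _ , refl)) aj≢ai bi∼aj = aj≢ai (cong a (collinear-ab⇒≡ (collinear-sym bi∼aj)))
    misses _ (inj₂ refl) _ bi∼cv = to (∈-δK v) (collinear-bc⇒∈ bi∼cv) φ⁻¹i∈v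

  b-blind : ∀ i → Blind (b i)
  b-blind i with through i (φ ⟨$⟩ˡ i)
  ... | v , i∈v , φ⁻¹i∈v =
    blind (a i) (λ ()) (pLine i , inj₂ (inj₂ refl) , inj₂ (inj₁ refl))
          (bLine (δK φ (κ v))) (inj₁ (i , i∈δκv , refl)) misses
    where
    i∈δκv : i ∈₂ δK φ (κ v)
    i∈δκv = from (∈-δK (κ v)) λ φ⁻¹i∈κv → to (κ-complement v _) φ⁻¹i∈κv φ⁻¹i∈v
    misses : ∀ w → Inc N (δK φ) w (bLine (δK φ (κ v))) → w ≢ b i → ¬ Collinear (a i) w
    misses _ (inj₁ (j , _ , refl)) bj≢bi ai∼bj = bj≢bi (cong b (sym (collinear-ab⇒≡ ai∼bj)))
    misses _ (inj₂ (w , δw≡δκv , refl)) _ ai∼cw =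
      to (κ-complement v _) (subst (i ∈₂_) (δK-injective δw≡δκv) (collinear-ac⇒∈ ai∼cw)) i∈v

  c-blind : ∀ {u} → δK φ u ≢ u → Blind (c u)
  c-blind {u} δu≢u with ≢⇒∃∈∉ (δu≢u ∘ sym)
  ... | t , t∈u , t∉δu =
    blind (a t) (λ ()) (aLine u , inj₂ refl , inj₁ (t , t∈u , refl))
          (bLine (δK φ u)) (inj₂ (u , refl , refl)) misses
    where
    misses : ∀ w → Inc N (δK φ) w (bLine (δK φ u)) → w ≢ c u → ¬ Collinear (a t) w
    misses _ (inj₁ (k , k∈δu , refl)) _ at∼bk = t∉δu (subst (_∈₂ δK φ u) (sym (collinear-ab⇒≡ at∼bk)) k∈δu)
    misses _ (inj₂ (w , δw≡δu , refl)) cw≢cu _ = cw≢cu (cong c (δK-injective δw≡δu))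

  module _ {u} (δu≡u : δK φ u ≡ u) where

    φ⁻¹-leaves : ∀ {t} → t ∈₂ u → ¬ (φ ⟨$⟩ˡ t) ∈₂ u
    φ⁻¹-leaves t∈u = to (∈-δK u) (subst (_ ∈₂_) (sym δu≡u) t∈u)

    kinked-via : ∀ {t v} → t ∈₂ u → t ∈₂ v → (φ ⟨$⟩ˡ t) ∈₂ v → Joined u v → Kinked (c u)
    kinked-via {t} {v} t∈u t∈v φ⁻¹t∈v (k , u∈k , v∈k) =
      kinked (b t) (a t) (c v) (λ ()) (λ ()) (λ { refl → v≢u refl })
        (bLine u , inj₂ (u , δu≡u , refl) , inj₁ (t , t∈u , refl))
        (aLine u , inj₂ refl , inj₁ (t , t∈u , refl))
        (vLine k , (u , u∈k , refl) , (v , v∈k , refl))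
        (pLine t , (λ { (inj₁ ()) ; (inj₂ (inj₁ ())) ; (inj₂ (inj₂ ())) }) , inj₂ (inj₂ refl) , inj₂ (inj₁ refl))
        (aLine v , (λ { (inj₁ (_ , _ , ())) ; (inj₂ refl) → v≢u refl }) , inj₁ (t , t∈v , refl) , inj₂ refl)
        (λ bt∼cv → to (∈-δK v) (collinear-bc⇒∈ bt∼cv) φ⁻¹t∈v)
      where
      v≢u : v ≢ u
      v≢u refl = φ⁻¹-leaves t∈u φ⁻¹t∈v

    c-kinked : Kinked (c u)
    c-kinked with through (lo u) (φ ⟨$⟩ˡ lo u) | through (hi u) (φ ⟨$⟩ˡ hi u)
    ... | v₁ , lo∈v₁ , φ⁻¹lo∈v₁ | v₂ , hi∈v₂ , φ⁻¹hi∈v₂ =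
      Sum.[ kinked-via (inj₁ refl) lo∈v₁ φ⁻¹lo∈v₁ , kinked-via (inj₂ refl) hi∈v₂ φ⁻¹hi∈v₂ ]
        (joined-to-one-of u v₁≢v₂)
      where
      v₁≢v₂ : v₁ ≢ v₂
      v₁≢v₂ v₁≡v₂ = φ⁻¹-leaves {hi u} (inj₂ refl) (subst ((φ ⟨$⟩ˡ hi u) ∈₂_) (sym u≡v₂) φ⁻¹hi∈v₂)
        where
        u≡v₂ : u ≡ v₂
        u≡v₂ = ⊆⇒≡ (subst (lo u ∈₂_) v₁≡v₂ lo∈v₁) hi∈v₂

  irregular-unless-p : ∀ x → x ≡ p ⊎ Irregular x
  irregular-unless-p p = inj₁ refl
  irregular-unless-p (a i) = inj₂ (inj₁ (a-blind i))
  irregular-unless-p (b i) = inj₂ (inj₁ (b-blind i))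
  irregular-unless-p (c u) with δK φ u ≟₂ u
  ... | yes δu≡u = inj₂ (inj₂ (c-kinked δu≡u))
  ... | no δu≢u = inj₂ (inj₁ (c-blind δu≢u))

corollary4p2 : (N : Veblen) (φ : Permutation′ 4) (f : Point ⤖ Point) →
               IsAutomorphism N (δK φ) f → Bijection.to f p ≡ p
corollary4p2 N φ f (image , preimage) =
  Sum.[ id , ⊥-elim ∘ p-regular ∘ irregular-reflected ] (irregular-unless-p (Bijection.to f p))
  where
  open 𝔎Properties N φ
  open Reflection f image preimage
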